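{- Let $F$ be a field of characteristic $p>0$ and let $\varphi,\psi$ be anisotropic quasilinear $p$-forms over $F$ such that $\mathrm{ndeg}_F(\varphi\otimes\psi)=\mathrm{ndeg}_F\varphi\cdot\mathrm{ndeg}_F\psi$. Then $\varphi\otimes\psi$ is anisotropic.
   Context: A quasilinear $p$-form over $F$ ($\mathrm{char}\,F=p$) is a map $\varphi:V\to F$ on a finite-dimensional $F$-vector space with $\varphi(av)=a^p\varphi(v)$, $\varphi(v+w)=\varphi(v)+\varphi(w)$; $\langle c_1,\dots,c_n\rangle$ denotes $\sum c_iX_i^p$, and $\langle c_1,\dots,c_n\rangle\otimes\langle d_1,\dots,d_m\rangle=\langle c_id_j\rangle_{1\le i\le n,1\le j\le m}$. It is anisotropic if $\varphi(v)=0$ implies $v=0$. With $D_F^*(\varphi)$ the set of nonzero values of $\varphi$, the norm field is $N_F(\varphi)=F^p(a/b\mid a,b\in D_F^*(\varphi))$ and the norm degree is $\mathrm{ndeg}_F\varphi=[N_F(\varphi):F^p]$. -}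

module Defs where

open import Level using (Level; _⊔_; suc)
open import Algebra.Bundles using (CommutativeRing)
open import Data.Nat using (ℕ; zero) renaming (suc to sucℕ; _*_ to _*ℕ_)
open import Data.Nat.Primality using (Prime)
open import Data.Fin using (Fin; remQuot) renaming (zero to fzero; suc to fsuc)
open import Data.Product using (Σ; ∃; _×_; _,_; proj₁; proj₂)
open import Relation.Nullary using (¬_)

record Field (c ℓ : Level) : Set (suc (c ⊔ ℓ)) where
  field
    commutativeRing : CommutativeRing c ℓ
  open CommutativeRing commutativeRing public
  field
    1≉0     : ¬ (1# ≈ 0#)
    inv     : (x : Carrier) → ¬ (x ≈ 0#) → Carrier
    inv-law : (x : Carrier) (x≉0 : ¬ (x ≈ 0#)) → (x * inv x x≉0) ≈ 1#

module FieldTheory {c ℓ : Level} (F : Field c ℓ) where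
  open Field F

  pow : Carrier → ℕ → Carrier
  pow x zero = 1#
  pow x (sucℕ n) = x * pow x n

  nat· : ℕ → Carrier
  nat· zero = 0#
  nat· (sucℕ n) = 1# + nat· n

  HasChar : ℕ → Set ℓ
  HasChar p = Prime p × (nat· p ≈ 0#)

  sumF : (n : ℕ) → (Fin n → Carrier) → Carrier
  sumF zero f = 0#
  sumF (sucℕ n) f = f fzero + sumF n (λ i → f (fsuc i))

  -- A quasilinear p-form ⟨c₁,…,cₙ⟩ is given by its coefficient vector.
  QForm : ℕ → Set c
  QForm n = Fin n → Carrier

  eval : (p : ℕ) {n : ℕ} → QForm n → (Fin n → Carrier) → Carrier
  eval p {n} φ x = sumF n (λ i → φ i * pow (x i) p)

  -- ⟨c_i⟩ ⊗ ⟨d_j⟩ = ⟨c_i d_j⟩  (indexed by Fin (n * m) ≅ Fin n × Fin m)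
  _⊗_ : {n m : ℕ} → QForm n → QForm m → QForm (n *ℕ m)
  _⊗_ {n} {m} φ ψ k = φ (proj₁ (remQuot {n} m k)) * ψ (proj₂ (remQuot {n} m k))

  Anisotropic : (p : ℕ) {n : ℕ} → QForm n → Set (c ⊔ ℓ)
  Anisotropic p {n} φ = (x : Fin n → Carrier) → eval p φ x ≈ 0# → (i : Fin n) → x i ≈ 0#

  InD* : (p : ℕ) {n : ℕ} → QForm n → Carrier → Set (c ⊔ ℓ)
  InD* p {n} φ a = (¬ (a ≈ 0#)) × Σ (Fin n → Carrier) (λ x → eval p φ x ≈ a)

  -- membership in the norm field N_F(φ) = F^p(a/b | a,b ∈ D*_F(φ)):
  -- the smallest subfield of F containing F^p and all such quotients.
  data InN (p : ℕ) {n : ℕ} (φ : QForm n) : Carrier → Set (c ⊔ ℓ) where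
    pth  : (y : Carrier) → InN p φ (pow y p)
    quot : (a b : Carrier) → InD* p φ a → (hb : InD* p φ b) →
           InN p φ (a * inv b (proj₁ hb))
    add  : {x y : Carrier} → InN p φ x → InN p φ y → InN p φ (x + y)
    mul  : {x y : Carrier} → InN p φ x → InN p φ y → InN p φ (x * y)
    neg  : {x : Carrier} → InN p φ x → InN p φ (- x)
    inve : {x : Carrier} → InN p φ x → (x≉0 : ¬ (x ≈ 0#)) → InN p φ (inv x x≉0)
    resp : {x y : Carrier} → x ≈ y → InN p φ x → InN p φ y

  -- ndeg_F φ = [N_F(φ) : F^p] = k : there is a basis e₁,…,e_k of N_F(φ)
  -- over F^p (coefficients are p-th powers λᵢ^p).
  HasNDeg : (p : ℕ) {n : ℕ} → QForm n → ℕ → Set (c ⊔ ℓ)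
  HasNDeg p φ k =
    Σ (Fin k → Carrier) λ e →
      ((i : Fin k) → InN p φ (e i))
    × ((λ' : Fin k → Carrier) → sumF k (λ i → pow (λ' i) p * e i) ≈ 0# →
         (i : Fin k) → λ' i ≈ 0#)
    × ((x : Carrier) → InN p φ x →
         Σ (Fin k → Carrier) λ λ' → x ≈ sumF k (λ i → pow (λ' i) p * e i))

-- Let e, f, g be F^p-bases of the norm fields N(φ), N(ψ), N(φ ⊗ ψ), of sizes a, b and a b.
-- The a b products eₛ fₜ lie in N(φ ⊗ ψ); conversely N(φ ⊗ ψ) lies in their F^p-span, because
-- up to the factor φ(i₀) ψ(j₀) every value of φ ⊗ ψ is an F^p-combination of products of the
-- normalised coefficients φᵢ/φ(i₀) ∈ N(φ) and ψⱼ/ψ(j₀) ∈ N(ψ). Since g is independent of the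
-- same size, so are the products (a determinant argument: equality in F need not be decidable).
-- Now let Σ xᵢⱼᵖ φᵢ ψⱼ = 0 and write φᵢ/φ(i₀) = Σₛ αᵢₛᵖ eₛ, ψⱼ/ψ(j₀) = Σₜ βⱼₜᵖ fₜ. Comparing
-- coefficients of eₛ fₜ gives Σᵢ (Σⱼ xᵢⱼ βⱼₜ) αᵢₛ = 0, so φ(Σⱼ xᵢⱼ βⱼₜ)ᵢ = 0 and anisotropy of φ
-- gives Σⱼ xᵢⱼ βⱼₜ = 0; then ψ(xᵢⱼ)ⱼ = 0 and anisotropy of ψ gives xᵢⱼ = 0.

module Submission where

open import Defs

open import Level using (Level; _⊔_)
open import Data.Empty using (⊥-elim)
open import Data.Fin
  using (Fin; toℕ; fromℕ; fromℕ<; punchIn; punchOut; lift; splitAt; quotRem; remQuot; combine; _≟_)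
  renaming (zero to fzero; suc to fsuc)
open import Data.Fin.Properties
  using (suc-injective; toℕ-fromℕ; toℕ-fromℕ<; toℕ-injective; toℕ<n; remQuot-combine; combine-remQuot;
         all?; any?; ¬∀⟶∃¬; pigeonhole; punchOut-injective; <⇒≢)
open import Data.Nat using (ℕ; zero; suc; pred; _<_; _≤_; _!; _∸_; s≤s; z≤n; nonTrivial⇒≢1)
  renaming (_+_ to _+ℕ_; _*_ to _*ℕ_)
import Data.Nat.Properties as ℕ
open import Data.Nat.Combinatorics using (nCn≡1; nCk≡n!/k![n-k]!; k![n∸k]!∣n!)
  renaming (_C_ to _choose_)
open import Data.Nat.Divisibility using (_∣_; _∤_; ∣⇒≤; ∣1⇒≡1; m∣m*n; divides)
open import Data.Nat.DivMod using (m/n*n≡m)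
open import Data.Nat.Primality using (Prime; ¬prime[0]; euclidsLemma; prime⇒nonTrivial; prime⇒nonZero)
open import Data.Product using (Σ; _×_; _,_; proj₁; proj₂)
import Data.Product as Product
open import Data.Sum using (_⊎_; inj₁; inj₂; [_,_]′)
import Data.Sum as Sum
open import Data.Unit.Polymorphic using (⊤)
open import Data.Vec.Functional using (updateAt)
open import Data.Vec.Functional.Properties using (updateAt-updates; updateAt-minimal; updateAt-updateAt)
open import Function using (_∘_)
open import Relation.Nullary using (¬_; Dec; yes; no)
open import Relation.Binary.PropositionalEquality as ≡ using (_≡_; _≢_; _≗_)

prime∤! : ∀ {p} → Prime p → ∀ {j} → j < p → p ∤ j !
prime∤! pr {zero}  _   p∣1 = nonTrivial⇒≢1 {{prime⇒nonTrivial pr}} (∣1⇒≡1 p∣1)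
prime∤! pr {suc j} j<p p∣j! with euclidsLemma (suc j) (j !) pr p∣j!
... | inj₁ p∣1+j = ℕ.<⇒≱ j<p (∣⇒≤ p∣1+j)
... | inj₂ p∣j!  = prime∤! pr (ℕ.<-trans (ℕ.n<1+n j) j<p) p∣j!

-- p! = k! (p ∸ k)! (p choose k), and p divides neither factorial.
prime∣choose : ∀ {p} → Prime p → ∀ {k} → 0 < k → k < p → p ∣ p choose k
prime∣choose {p@(suc p′)} pr {k} 0<k k<p
  with euclidsLemma (k ! *ℕ (p ∸ k) !) (p choose k) pr p∣d*C
  where
  instance
    _ = k ℕ.!* (p ∸ k) !≢0
  k≤p : k ≤ p
  k≤p = ℕ.<⇒≤ k<p
  d*C≡p! : k ! *ℕ (p ∸ k) ! *ℕ (p choose k) ≡ p !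
  d*C≡p! = ≡.trans (≡.cong (k ! *ℕ (p ∸ k) ! *ℕ_) (nCk≡n!/k![n-k]! k≤p))
             (≡.trans (ℕ.*-comm (k ! *ℕ (p ∸ k) !) _) (m/n*n≡m (k![n∸k]!∣n! k≤p)))
  p∣d*C : p ∣ k ! *ℕ (p ∸ k) ! *ℕ (p choose k)
  p∣d*C = ≡.subst (p ∣_) (≡.sym d*C≡p!) (m∣m*n (p′ !))
... | inj₂ p∣C = p∣C
... | inj₁ p∣d with euclidsLemma (k !) ((p ∸ k) !) pr p∣d
...   | inj₁ p∣k!   = ⊥-elim (prime∤! pr k<p p∣k!)
...   | inj₂ p∣p-k! = ⊥-elim (prime∤! pr (ℕ.∸-monoʳ-< 0<k (ℕ.<⇒≤ k<p)) p∣p-k!)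

module _ {c ℓ : Level} (F : Field c ℓ) where
  open Field F
  open FieldTheory F
  open import Algebra.Properties.Ring ring
    using (-‿distribˡ-*; -‿distribʳ-*; -‿involutive; -0#≈0#; -‿+-comm; +-inverseʳ-unique; +-inverseˡ-unique; x∙y⁻¹≈ε⇒x≈y)
  open import Algebra.Properties.Semiring.Sum semiring
    using (sum; sum-cong-≗; ∑-distrib-+; ∑-comm; *-distribˡ-sum)
  open import Algebra.Properties.Semiring.Exp semiring using (_^_)
  open import Algebra.Properties.CommutativeSemiring.Exp commutativeSemiring using (^-distrib-*)
  open import Algebra.Properties.Monoid.Mult +-monoid using (×-homo-1; ×-assocˡ; ×-congʳ)
    renaming (_×_ to _·_)
  open import Algebra.Properties.CommutativeSemiring.Binomial commutativeSemiring
    using (theorem; binomialTerm)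
  open import Algebra.Properties.CommutativeSemigroup *-commutativeSemigroup
    using (x∙yz≈y∙xz; interchange)
  open import Algebra.Properties.CommutativeSemigroup +-commutativeSemigroup
    using () renaming (interchange to +-interchange)
  open import Relation.Binary.Reasoning.Setoid setoid

  sumF≡sum : ∀ n (f : Fin n → Carrier) → sumF n f ≡ sum f
  sumF≡sum zero    f = ≡.refl
  sumF≡sum (suc n) f = ≡.cong (f fzero +_) (sumF≡sum n (λ i → f (fsuc i)))

  sumF-cong : ∀ n {f g : Fin n → Carrier} → (∀ i → f i ≈ g i) → sumF n f ≈ sumF n g
  sumF-cong zero    f≈g = refl
  sumF-cong (suc n) f≈g = +-cong (f≈g fzero) (sumF-cong n (λ i → f≈g (fsuc i)))

  sumF-zero : ∀ n {f : Fin n → Carrier} → (∀ i → f i ≈ 0#) → sumF n f ≈ 0#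
  sumF-zero zero    f≈0 = refl
  sumF-zero (suc n) f≈0 = trans (+-cong (f≈0 fzero) (sumF-zero n (λ i → f≈0 (fsuc i)))) (+-identityˡ 0#)

  sumF-distrib-+ : ∀ n (f g : Fin n → Carrier) →
                   sumF n (λ i → f i + g i) ≈ sumF n f + sumF n g
  sumF-distrib-+ n f g = begin
    sumF n (λ i → f i + g i) ≡⟨ sumF≡sum n _ ⟩
    sum (λ i → f i + g i)    ≈⟨ ∑-distrib-+ f g ⟩
    sum f + sum g            ≡⟨ ≡.cong₂ _+_ (sumF≡sum n f) (sumF≡sum n g) ⟨
    sumF n f + sumF n g      ∎

  sumF-comm : ∀ n m (f : Fin n → Fin m → Carrier) →
              sumF n (λ i → sumF m (f i)) ≈ sumF m (λ j → sumF n (λ i → f i j))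
  sumF-comm n m f = begin
    sumF n (λ i → sumF m (f i))            ≡⟨ ≡.trans (sumF≡sum n _) (sum-cong-≗ (λ i → sumF≡sum m (f i))) ⟩
    sum (λ i → sum (f i))                  ≈⟨ ∑-comm f ⟩
    sum (λ j → sum (λ i → f i j))          ≡⟨ ≡.trans (sumF≡sum m _) (sum-cong-≗ (λ j → sumF≡sum n (λ i → f i j))) ⟨
    sumF m (λ j → sumF n (λ i → f i j))    ∎

  *-distribˡ-sumF : ∀ n x (f : Fin n → Carrier) → x * sumF n f ≈ sumF n (λ i → x * f i)
  *-distribˡ-sumF n x f = begin
    x * sumF n f             ≡⟨ ≡.cong (x *_) (sumF≡sum n f) ⟩
    x * sum f                ≈⟨ *-distribˡ-sum x f ⟩
    sum (λ i → x * f i)      ≡⟨ sumF≡sum n _ ⟨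
    sumF n (λ i → x * f i)   ∎

  *-distribʳ-sumF : ∀ n x (f : Fin n → Carrier) → sumF n f * x ≈ sumF n (λ i → f i * x)
  *-distribʳ-sumF n x f =
    trans (*-comm _ x) (trans (*-distribˡ-sumF n x f) (sumF-cong n (λ i → *-comm x (f i))))

  -‿distrib-sumF : ∀ n (f : Fin n → Carrier) → - sumF n f ≈ sumF n (λ i → - f i)
  -‿distrib-sumF zero    f = -0#≈0#
  -‿distrib-sumF (suc n) f =
    trans (sym (-‿+-comm _ _)) (+-congˡ (-‿distrib-sumF n (λ i → f (fsuc i))))

  sumF-single : ∀ n (f : Fin n → Carrier) k → (∀ i → i ≢ k → f i ≈ 0#) → sumF n f ≈ f k
  sumF-single (suc n) f fzero    f≈0 =
    trans (+-congˡ (sumF-zero n (λ i → f≈0 (fsuc i) (λ ())))) (+-identityʳ _)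
  sumF-single (suc n) f (fsuc k) f≈0 =
    trans (+-congʳ (f≈0 fzero (λ ())))
      (trans (+-identityˡ _)
        (sumF-single n (λ i → f (fsuc i)) k (λ i i≢k → f≈0 (fsuc i) (λ e → i≢k (suc-injective e)))))

  sumF-splitAt : ∀ m k (g : Fin m ⊎ Fin k → Carrier) →
    sumF (m +ℕ k) (λ i → g (splitAt m i)) ≈ sumF m (λ i → g (inj₁ i)) + sumF k (λ i → g (inj₂ i))
  sumF-splitAt zero    k g = sym (+-identityˡ _)
  sumF-splitAt (suc m) k g =
    trans (+-congˡ (sumF-splitAt m k (λ s → g (Sum.map₁ fsuc s)))) (sym (+-assoc _ _ _))

  sumF-remQuot : ∀ n m (u : Fin n → Fin m → Carrier) →
    sumF (n *ℕ m) (λ k → u (proj₁ (remQuot {n} m k)) (proj₂ (remQuot {n} m k)))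
      ≈ sumF n (λ i → sumF m (u i))
  sumF-remQuot zero    m u = refl
  sumF-remQuot (suc n) m u =
    trans (sumF-splitAt m (n *ℕ m) (λ s → u (proj₂ (split s)) (proj₁ (split s))))
          (+-congˡ (sumF-remQuot n m (λ i → u (fsuc i))))
    where
    split : Fin m ⊎ Fin (n *ℕ m) → Fin m × Fin (suc n)
    split = [ (_, fzero) , (λ r → Product.map₂ fsuc (quotRem {n} m r)) ]′

  sumF-*-⊗ : ∀ n m (x : Fin (n *ℕ m) → Carrier) (u : Fin n → Carrier) (v : Fin m → Carrier) →
    sumF (n *ℕ m) (λ k → x k * (u ⊗ v) k) ≈ sumF n (λ i → sumF m (λ j → x (combine i j) * v j) * u i)
  sumF-*-⊗ n m x u v = begin
    sumF (n *ℕ m) (λ k → x k * (u ⊗ v) k)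
      ≈⟨ sumF-cong (n *ℕ m) (λ k → *-congʳ (reflexive (≡.cong x (≡.sym (combine-remQuot {n} m k))))) ⟩
    sumF (n *ℕ m) (λ k → X (proj₁ (remQuot {n} m k)) (proj₂ (remQuot {n} m k)) * (u ⊗ v) k)
      ≈⟨ sumF-remQuot n m (λ i j → X i j * (u i * v j)) ⟩
    sumF n (λ i → sumF m (λ j → X i j * (u i * v j)))
      ≈⟨ sumF-cong n (λ i → trans (sumF-cong m (λ j → trans (x∙yz≈y∙xz _ _ _) (*-comm (u i) _)))
                                   (sym (*-distribʳ-sumF m (u i) _))) ⟩
    sumF n (λ i → sumF m (λ j → X i j * v j) * u i) ∎
    where
    X : Fin n → Fin m → Carrier
    X i j = x (combine i j)

  inv-unique : ∀ y (y≉0 : ¬ (y ≈ 0#)) z → y * z ≈ 1# → z ≈ inv y y≉0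
  inv-unique y y≉0 z yz≈1 = begin
    z                   ≈⟨ *-identityˡ z ⟨
    1# * z              ≈⟨ *-congʳ (trans (*-comm y⁻¹ y) (inv-law y y≉0)) ⟨
    (y⁻¹ * y) * z       ≈⟨ *-assoc y⁻¹ y z ⟩
    y⁻¹ * (y * z)       ≈⟨ *-congˡ yz≈1 ⟩
    y⁻¹ * 1#            ≈⟨ *-identityʳ y⁻¹ ⟩
    y⁻¹                 ∎
    where
    y⁻¹ : Carrier
    y⁻¹ = inv y y≉0

  inv-cong : ∀ {y z} (y≉0 : ¬ (y ≈ 0#)) (z≉0 : ¬ (z ≈ 0#)) → y ≈ z → inv y y≉0 ≈ inv z z≉0
  inv-cong {y} {z} y≉0 z≉0 y≈z = inv-unique z z≉0 _ (trans (*-congʳ (sym y≈z)) (inv-law y y≉0))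

  x≉0∧xy≈0⇒y≈0 : ∀ {x y} → ¬ (x ≈ 0#) → x * y ≈ 0# → y ≈ 0#
  x≉0∧xy≈0⇒y≈0 {x} {y} x≉0 xy≈0 = begin
    y                   ≈⟨ *-identityˡ y ⟨
    1# * y              ≈⟨ *-congʳ (trans (*-comm x⁻¹ x) (inv-law x x≉0)) ⟨
    (x⁻¹ * x) * y       ≈⟨ *-assoc x⁻¹ x y ⟩
    x⁻¹ * (x * y)       ≈⟨ *-congˡ xy≈0 ⟩
    x⁻¹ * 0#            ≈⟨ zeroʳ x⁻¹ ⟩
    0#                  ∎
    where
    x⁻¹ : Carrier
    x⁻¹ = inv x x≉0

  x≉0∧y≉0⇒xy≉0 : ∀ {x y} → ¬ (x ≈ 0#) → ¬ (y ≈ 0#) → ¬ (x * y ≈ 0#)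
  x≉0∧y≉0⇒xy≉0 {x} {y} x≉0 y≉0 xy≈0 = x≉0 (x≉0∧xy≈0⇒y≈0 y≉0 (trans (*-comm y x) xy≈0))

  inv-nonzero : ∀ y (y≉0 : ¬ (y ≈ 0#)) → ¬ (inv y y≉0 ≈ 0#)
  inv-nonzero y y≉0 y⁻¹≈0 = 1≉0 (trans (sym (inv-law y y≉0)) (trans (*-congˡ y⁻¹≈0) (zeroʳ y)))

  y*[x/y]≈x : ∀ x y (y≉0 : ¬ (y ≈ 0#)) → y * (x * inv y y≉0) ≈ x
  y*[x/y]≈x x y y≉0 = trans (x∙yz≈y∙xz y x _) (trans (*-congˡ (inv-law y y≉0)) (*-identityʳ x))

  yx/y≈x : ∀ x y (y≉0 : ¬ (y ≈ 0#)) → (y * x) * inv y y≉0 ≈ x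
  yx/y≈x x y y≉0 = trans (*-assoc y x _) (y*[x/y]≈x x y y≉0)

  xd/yd≈x/y : ∀ x y d (y≉0 : ¬ (y ≈ 0#)) (yd≉0 : ¬ (y * d ≈ 0#)) →
              (x * d) * inv (y * d) yd≉0 ≈ x * inv y y≉0
  xd/yd≈x/y x y d y≉0 yd≉0 = trans (*-assoc x d _) (*-congˡ (inv-unique y y≉0 _
    (trans (sym (*-assoc y d _)) (inv-law (y * d) yd≉0))))

  dx/dy≈x/y : ∀ x y d (y≉0 : ¬ (y ≈ 0#)) (dy≉0 : ¬ (d * y ≈ 0#)) →
              (d * x) * inv (d * y) dy≉0 ≈ x * inv y y≉0
  dx/dy≈x/y x y d y≉0 dy≉0 = trans (*-cong (*-comm d x) (inv-cong dy≉0 yd≉0 (*-comm d y)))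
                                    (xd/yd≈x/y x y d y≉0 yd≉0)
    where
    yd≉0 : ¬ (y * d ≈ 0#)
    yd≉0 yd≈0 = dy≉0 (trans (*-comm d y) yd≈0)

  -- The Frobenius map

  pow≡^ : ∀ x n → pow x n ≡ x ^ n
  pow≡^ x zero    = ≡.refl
  pow≡^ x (suc n) = ≡.cong (x *_) (pow≡^ x n)

  pow-cong : ∀ n {x y} → x ≈ y → pow x n ≈ pow y n
  pow-cong zero    x≈y = refl
  pow-cong (suc n) x≈y = *-cong x≈y (pow-cong n x≈y)

  pow-1 : ∀ n → pow 1# n ≈ 1#
  pow-1 zero    = refl
  pow-1 (suc n) = trans (*-identityˡ _) (pow-1 n)

  pow-distrib-* : ∀ n x y → pow (x * y) n ≈ pow x n * pow y n
  pow-distrib-* n x y = begin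
    pow (x * y) n      ≡⟨ pow≡^ (x * y) n ⟩
    (x * y) ^ n        ≈⟨ ^-distrib-* x y n ⟩
    x ^ n * y ^ n      ≡⟨ ≡.cong₂ _*_ (pow≡^ x n) (pow≡^ y n) ⟨
    pow x n * pow y n  ∎

  nat·*≈· : ∀ n x → nat· n * x ≈ n · x
  nat·*≈· zero    x = zeroˡ x
  nat·*≈· (suc n) x = begin
    (1# + nat· n) * x     ≈⟨ distribʳ x 1# (nat· n) ⟩
    1# * x + nat· n * x   ≈⟨ +-cong (*-identityˡ x) (nat·*≈· n x) ⟩
    x + n · x             ∎

  char∣m⇒m·x≈0 : ∀ {p} → HasChar p → ∀ {m} → p ∣ m → ∀ x → m · x ≈ 0#
  char∣m⇒m·x≈0 {p} (_ , p≈0) (divides q ≡.refl) x = begin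
    (q *ℕ p) · x   ≈⟨ ×-assocˡ x q p ⟨
    q · (p · x)    ≈⟨ ×-congʳ q (trans (sym (nat·*≈· p x)) (trans (*-congʳ p≈0) (zeroˡ x))) ⟩
    q · 0#         ≈⟨ trans (sym (nat·*≈· q 0#)) (zeroʳ _) ⟩
    0#             ∎

  -- In the binomial expansion all terms but the outer two have coefficients divisible by p.
  pow-+-char : ∀ {p} → HasChar p → ∀ x y → pow (x + y) p ≈ pow x p + pow y p
  pow-+-char {zero} (p-prime , _) = ⊥-elim (¬prime[0] p-prime)
  pow-+-char {p@(suc p′)} char@(p-prime , _) x y = begin
    pow (x + y) p                                   ≡⟨ pow≡^ (x + y) p ⟩
    (x + y) ^ p                                     ≈⟨ theorem p x y ⟩
    sum term                                        ≡⟨ sumF≡sum (suc p) term ⟨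
    term fzero + sumF p (λ k → term (fsuc k))       ≈⟨ +-congˡ (sumF-single p _ (fromℕ p′) middle) ⟩
    term fzero + term (fsuc (fromℕ p′))             ≈⟨ +-comm _ _ ⟩
    term (fsuc (fromℕ p′)) + term fzero             ≈⟨ +-cong last first ⟩
    pow x p + pow y p                               ∎
    where
    term : Fin (suc p) → Carrier
    term = binomialTerm x y p
    first : term fzero ≈ pow y p
    first = trans (×-homo-1 _) (trans (*-identityˡ _) (reflexive (≡.sym (pow≡^ y p))))
    last : term (fsuc (fromℕ p′)) ≈ pow x p
    last rewrite toℕ-fromℕ p′ | nCn≡1 p | ℕ.n∸n≡0 p =
      trans (×-homo-1 _) (trans (*-identityʳ _) (reflexive (≡.sym (pow≡^ x p))))
    middle : ∀ k → k ≢ fromℕ p′ → term (fsuc k) ≈ 0#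
    middle k k≢p′ = char∣m⇒m·x≈0 char (prime∣choose p-prime (s≤s z≤n) (s≤s k<p′)) _
      where
      k<p′ : toℕ k < p′
      k<p′ = ℕ.≤∧≢⇒< (ℕ.≤-pred (toℕ<n k))
               (λ k≡p′ → k≢p′ (toℕ-injective (≡.trans k≡p′ (≡.sym (toℕ-fromℕ p′)))))

  -- Determinants

  δ : ∀ {n} → Fin n → Fin n → Carrier
  δ fzero    fzero    = 1#
  δ fzero    (fsuc _) = 0#
  δ (fsuc _) fzero    = 0#
  δ (fsuc i) (fsuc j) = δ i j

  δ-diag : ∀ {n} (i : Fin n) → δ i i ≈ 1#
  δ-diag fzero    = refl
  δ-diag (fsuc i) = δ-diag i

  δ-off : ∀ {n} (i j : Fin n) → i ≢ j → δ i j ≈ 0#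
  δ-off fzero    fzero    i≢j = ⊥-elim (i≢j ≡.refl)
  δ-off fzero    (fsuc _) _   = refl
  δ-off (fsuc _) fzero    _   = refl
  δ-off (fsuc i) (fsuc j) i≢j = δ-off i j (i≢j ∘ ≡.cong fsuc)

  Matrix : ℕ → Set c
  Matrix n = Fin n → Fin n → Carrier

  infix 4 _≈ᵛ_
  _≈ᵛ_ : ∀ {n} → (Fin n → Carrier) → (Fin n → Carrier) → Set ℓ
  u ≈ᵛ v = ∀ j → u j ≈ v j

  ≡⇒≈ᵛ : ∀ {n} {u v : Fin n → Carrier} → u ≡ v → u ≈ᵛ v
  ≡⇒≈ᵛ ≡.refl j = refl

  altSum : ∀ n → (Fin n → Carrier) → Carrier
  altSum zero    f = 0#
  altSum (suc n) f = f fzero - altSum n (f ∘ fsuc)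

  minor : ∀ {n} → Matrix (suc n) → Fin (suc n) → Matrix n
  minor A j r c = A (fsuc r) (punchIn j c)

  det : ∀ n → Matrix n → Carrier
  det zero    A = 1#
  det (suc n) A = altSum (suc n) (λ j → A fzero j * det n (minor A j))

  altSum-cong : ∀ n {f g : Fin n → Carrier} → f ≈ᵛ g → altSum n f ≈ altSum n g
  altSum-cong zero    f≈g = refl
  altSum-cong (suc n) f≈g = +-cong (f≈g fzero) (-‿cong (altSum-cong n (f≈g ∘ fsuc)))

  altSum-zero : ∀ n {f : Fin n → Carrier} → (∀ i → f i ≈ 0#) → altSum n f ≈ 0#
  altSum-zero zero    f≈0 = refl
  altSum-zero (suc n) f≈0 =
    trans (+-cong (f≈0 fzero) (trans (-‿cong (altSum-zero n (f≈0 ∘ fsuc))) -0#≈0#)) (+-identityˡ 0#)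

  altSum-linear : ∀ n x {f g h : Fin n → Carrier} → (∀ i → f i ≈ x * g i + h i) →
                  altSum n f ≈ x * altSum n g + altSum n h
  altSum-linear zero    x f≈ = sym (trans (+-congʳ (zeroʳ x)) (+-identityˡ 0#))
  altSum-linear (suc n) x {f} {g} {h} f≈ = begin
    f fzero - altSum n (f ∘ fsuc)
      ≈⟨ +-cong (f≈ fzero) (-‿cong (altSum-linear n x (f≈ ∘ fsuc))) ⟩
    (x * g fzero + h fzero) - (x * altSum n (g ∘ fsuc) + altSum n (h ∘ fsuc))
      ≈⟨ +-congˡ (sym (-‿+-comm _ _)) ⟩
    (x * g fzero + h fzero) + (- (x * altSum n (g ∘ fsuc)) + - altSum n (h ∘ fsuc))
      ≈⟨ +-interchange _ _ _ _ ⟩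
    (x * g fzero + - (x * altSum n (g ∘ fsuc))) + (h fzero - altSum n (h ∘ fsuc))
      ≈⟨ +-congʳ (trans (+-congˡ (-‿distribʳ-* x _)) (sym (distribˡ x _ _))) ⟩
    x * altSum (suc n) g + altSum (suc n) h ∎

  altSum-neg : ∀ n (f : Fin n → Carrier) → altSum n (λ i → - f i) ≈ - altSum n f
  altSum-neg n f = begin
    altSum n (λ i → - f i)           ≈⟨ altSum-linear n (- 1#) (λ i → trans (-‿cong (sym (*-identityˡ _)))
                                          (trans (-‿distribˡ-* 1# (f i)) (sym (+-identityʳ _)))) ⟩
    - 1# * altSum n f + altSum n (λ _ → 0#) ≈⟨ +-cong (sym (-‿distribˡ-* 1# _)) (altSum-zero n (λ _ → refl)) ⟩
    - (1# * altSum n f) + 0#         ≈⟨ trans (+-identityʳ _) (-‿cong (*-identityˡ _)) ⟩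
    - altSum n f                      ∎

  det-cong : ∀ n {A B : Matrix n} → (∀ i → A i ≈ᵛ B i) → det n A ≈ det n B
  det-cong zero    A≈B = refl
  det-cong (suc n) A≈B =
    altSum-cong (suc n) (λ j → *-cong (A≈B fzero j) (det-cong n (λ r c → A≈B (fsuc r) (punchIn j c))))

  det-linear : ∀ n (A B C : Matrix n) i x → A i ≈ᵛ (λ j → x * B i j + C i j) →
    (∀ r → r ≢ i → A r ≈ᵛ B r) → (∀ r → r ≢ i → A r ≈ᵛ C r) → det n A ≈ x * det n B + det n C
  det-linear (suc n) A B C fzero x Ai≈ A≈B A≈C = altSum-linear (suc n) x (λ j → begin
    A fzero j * det n (minor A j)
      ≈⟨ *-congʳ (Ai≈ j) ⟩
    (x * B fzero j + C fzero j) * det n (minor A j)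
      ≈⟨ distribʳ _ _ _ ⟩
    (x * B fzero j) * det n (minor A j) + C fzero j * det n (minor A j)
      ≈⟨ +-cong (trans (*-assoc _ _ _) (*-congˡ (*-congˡ (det-cong n (λ r c → A≈B (fsuc r) (λ ()) _)))))
                (*-congˡ (det-cong n (λ r c → A≈C (fsuc r) (λ ()) _))) ⟩
    x * (B fzero j * det n (minor B j)) + C fzero j * det n (minor C j) ∎)
  det-linear (suc n) A B C (fsuc i) x Ai≈ A≈B A≈C = altSum-linear (suc n) x (λ j → begin
    A fzero j * det n (minor A j)
      ≈⟨ *-congˡ (det-linear n (minor A j) (minor B j) (minor C j) i x (Ai≈ ∘ punchIn j)
           (λ r r≢i c → A≈B (fsuc r) (r≢i ∘ suc-injective) (punchIn j c))
           (λ r r≢i c → A≈C (fsuc r) (r≢i ∘ suc-injective) (punchIn j c))) ⟩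
    A fzero j * (x * det n (minor B j) + det n (minor C j))
      ≈⟨ trans (distribˡ _ _ _) (+-congʳ (x∙yz≈y∙xz _ x _)) ⟩
    x * (A fzero j * det n (minor B j)) + A fzero j * det n (minor C j)
      ≈⟨ +-cong (*-congˡ (*-congʳ (A≈B fzero (λ ()) j))) (*-congʳ (A≈C fzero (λ ()) j)) ⟩
    x * (B fzero j * det n (minor B j)) + C fzero j * det n (minor C j) ∎)

  det-additive : ∀ n (A B C : Matrix n) i → A i ≈ᵛ (λ j → B i j + C i j) →
    (∀ r → r ≢ i → A r ≈ᵛ B r) → (∀ r → r ≢ i → A r ≈ᵛ C r) → det n A ≈ det n B + det n C
  det-additive n A B C i Aᵢ≈ A≈B A≈C =
    trans (det-linear n A B C i 1# (λ j → trans (Aᵢ≈ j) (+-congʳ (sym (*-identityˡ _)))) A≈B A≈C)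
          (+-congʳ (*-identityˡ _))

  det-zeroRow : ∀ n (A : Matrix n) i → (∀ j → A i j ≈ 0#) → det n A ≈ 0#
  det-zeroRow (suc n) A fzero    A₀≈0 =
    altSum-zero (suc n) (λ j → trans (*-congʳ (A₀≈0 j)) (zeroˡ (det n (minor A j))))
  det-zeroRow (suc n) A (fsuc i) Aᵢ≈0 =
    altSum-zero (suc n) (λ j → trans (*-congˡ (det-zeroRow n (minor A j) i (Aᵢ≈0 ∘ punchIn j))) (zeroʳ (A fzero j)))

  infixl 6 _[_]≔_
  _[_]≔_ : ∀ {n} → Matrix n → Fin n → (Fin n → Carrier) → Matrix n
  A [ i ]≔ u = updateAt A i (λ _ → u)

  []≔-at : ∀ {n} (A : Matrix n) i u → (A [ i ]≔ u) i ≈ᵛ u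
  []≔-at A i u = ≡⇒≈ᵛ (updateAt-updates i A)

  []≔-off : ∀ {n} (A : Matrix n) i u r → r ≢ i → (A [ i ]≔ u) r ≈ᵛ A r
  []≔-off A i u r r≢i = ≡⇒≈ᵛ (updateAt-minimal r i A r≢i)

  []≔-[]≔ : ∀ {n} (A : Matrix n) i u v → (A [ i ]≔ u) [ i ]≔ v ≗ A [ i ]≔ v
  []≔-[]≔ A i u v = updateAt-updateAt i A

  det-cong-≗ : ∀ n {A B : Matrix n} → A ≗ B → det n A ≈ det n B
  det-cong-≗ n A≗B = det-cong n (λ r → ≡⇒≈ᵛ (A≗B r))

  rows-agree : ∀ {n} {A B : Matrix n} {i j} → A i ≈ᵛ B i → A j ≈ᵛ B j →
               (∀ r → r ≢ i → r ≢ j → A r ≈ᵛ B r) → ∀ r → A r ≈ᵛ B r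
  rows-agree {i = i} {j} Aᵢ≈ Aⱼ≈ A≈ r with r ≟ i | r ≟ j
  ... | yes ≡.refl | _          = Aᵢ≈
  ... | no _       | yes ≡.refl = Aⱼ≈
  ... | no r≢i     | no r≢j     = A≈ r r≢i r≢j

  -- G j k is indexed by the ordered pair (j , punchIn j k) of distinct indices;
  -- pair-symmetry says that it only depends on the underlying unordered pair.
  PairSymmetric : ∀ t → (Fin (suc t) → Fin t → Carrier) → Set ℓ
  PairSymmetric zero    G = ⊤
  PairSymmetric (suc t) G =
    (∀ k → G fzero k ≈ G (fsuc k) fzero) × PairSymmetric t (λ j k → G (fsuc j) (fsuc k))

  PairSymmetric-cong : ∀ t {G H : Fin (suc t) → Fin t → Carrier} →
                       (∀ j k → G j k ≈ H j k) → PairSymmetric t G → PairSymmetric t H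
  PairSymmetric-cong zero    G≈H _            = _
  PairSymmetric-cong (suc t) G≈H (sym₀ , symₛ) =
    (λ k → trans (sym (G≈H fzero k)) (trans (sym₀ k) (G≈H (fsuc k) fzero))) ,
    PairSymmetric-cong t (λ j k → G≈H (fsuc j) (fsuc k)) symₛ

  doubleAltSum : ∀ t → (Fin (suc t) → Carrier) → (Fin (suc t) → Fin t → Carrier) → Carrier
  doubleAltSum t a G = altSum (suc t) (λ j → a j * altSum t (λ k → a (punchIn j k) * G j k))

  -- The terms for (j , k) and for the swapped pair carry opposite signs.
  doubleAltSum-vanishes : ∀ t a G → PairSymmetric t G → doubleAltSum t a G ≈ 0#
  doubleAltSum-vanishes zero    a G _ =
    trans (+-cong (zeroʳ (a fzero)) -0#≈0#) (+-identityˡ 0#)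
  doubleAltSum-vanishes (suc t) a G (sym₀ , symₛ) = begin
    a fzero * altSum (suc t) P - altSum (suc t) (λ j → a (fsuc j) * (a fzero * G (fsuc j) fzero - X j))
      ≈⟨ +-congˡ (-‿cong (altSum-linear (suc t) (a fzero)
           {λ j → a (fsuc j) * (a fzero * G (fsuc j) fzero - X j)} {P} {λ j → - (a (fsuc j) * X j)} (λ j → begin
           a (fsuc j) * (a fzero * G (fsuc j) fzero - X j)
             ≈⟨ distribˡ _ _ _ ⟩
           a (fsuc j) * (a fzero * G (fsuc j) fzero) + a (fsuc j) * - X j
             ≈⟨ +-cong (trans (x∙yz≈y∙xz _ _ _) (*-congˡ (*-congˡ (sym (sym₀ j))))) (sym (-‿distribʳ-* _ _)) ⟩
           a fzero * P j + - (a (fsuc j) * X j) ∎))) ⟩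
    a fzero * altSum (suc t) P - (a fzero * altSum (suc t) P + altSum (suc t) (λ j → - (a (fsuc j) * X j)))
      ≈⟨ +-congˡ (-‿cong (+-congˡ (trans (altSum-neg (suc t) (λ j → a (fsuc j) * X j))
           (trans (-‿cong (doubleAltSum-vanishes t (a ∘ fsuc) (λ j k → G (fsuc j) (fsuc k)) symₛ)) -0#≈0#)))) ⟩
    a fzero * altSum (suc t) P - (a fzero * altSum (suc t) P + 0#)
      ≈⟨ trans (+-congˡ (-‿cong (+-identityʳ _))) (-‿inverseʳ _) ⟩
    0# ∎
    where
    P : Fin (suc t) → Carrier
    P k = a (fsuc k) * G fzero k
    X : Fin (suc t) → Carrier
    X j = altSum t (λ k → a (fsuc (punchIn j k)) * G (fsuc j) (fsuc k))

  -- punchIn j ∘ punchIn k enumerates the columns outside {j , punchIn j k}.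
  punchIn²-pairSymmetric : ∀ t (Ψ : (Fin t → Fin (suc (suc t))) → Carrier) →
    (∀ {f g} → f ≗ g → Ψ f ≈ Ψ g) → PairSymmetric (suc t) (λ j k → Ψ (punchIn j ∘ punchIn k))
  punchIn²-pairSymmetric zero    Ψ Ψ-cong = (λ k → Ψ-cong (λ ())) , _
  punchIn²-pairSymmetric (suc t) Ψ Ψ-cong =
    (λ k → Ψ-cong (λ _ → ≡.refl)) ,
    PairSymmetric-cong (suc t)
      {λ j k → Ψ (lift 1 (punchIn j ∘ punchIn k))} {λ j k → Ψ (punchIn (fsuc j) ∘ punchIn (fsuc k))}
      (λ j k → Ψ-cong (λ { fzero → ≡.refl ; (fsuc _) → ≡.refl }))
      (punchIn²-pairSymmetric t (Ψ ∘ lift 1)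
        (λ f≗g → Ψ-cong (λ { fzero → ≡.refl ; (fsuc x) → ≡.cong fsuc (f≗g x) })))

  -- Expanding along the first two rows gives a double alternating sum over ordered column pairs.
  det-rows₀₁≈⇒det≈0 : ∀ m (A : Matrix (suc (suc m))) → A (fsuc fzero) ≈ᵛ A fzero → det (suc (suc m)) A ≈ 0#
  det-rows₀₁≈⇒det≈0 m A A₁≈A₀ =
    trans (altSum-cong (suc (suc m)) {g = λ j → A fzero j * altSum (suc m) (λ k → A fzero (punchIn j k) * Ψ (punchIn j ∘ punchIn k))}
             (λ j → *-congˡ (altSum-cong (suc m) {g = λ k → A fzero (punchIn j k) * Ψ (punchIn j ∘ punchIn k)}
               (λ k → *-congʳ (A₁≈A₀ (punchIn j k))))))
          (doubleAltSum-vanishes (suc m) (A fzero) (λ j k → Ψ (punchIn j ∘ punchIn k))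
            (punchIn²-pairSymmetric m Ψ (λ f≗g → det-cong m (λ r c → reflexive (≡.cong (A (fsuc (fsuc r))) (f≗g c))))))
    where
    Ψ : (Fin m → Fin (suc (suc m))) → Carrier
    Ψ f = det m (λ r c → A (fsuc (fsuc r)) (f c))

  Alternating : ℕ → Set (c ⊔ ℓ)
  Alternating n = ∀ (A : Matrix n) {i j} → i ≢ j → A i ≈ᵛ A j → det n A ≈ 0#

  Antisymmetric : ℕ → Set (c ⊔ ℓ)
  Antisymmetric n = ∀ (A B : Matrix n) {i j} → i ≢ j → B i ≈ᵛ A j → B j ≈ᵛ A i →
                    (∀ r → r ≢ i → r ≢ j → B r ≈ᵛ A r) → det n B ≈ - det n A

  -- D u v := det (A with rows i, j replaced by u, v) is bilinear and vanishes on the diagonal.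
  alternating⇒antisymmetric : ∀ n → Alternating n → Antisymmetric n
  alternating⇒antisymmetric n alt A B {i} {j} i≢j Bᵢ≈ Bⱼ≈ B≈ = begin
    det n B  ≈⟨ det-cong n (rows-agree (λ c → trans (Bᵢ≈ c) (sym (R-i b a c)))
                                        (λ c → trans (Bⱼ≈ c) (sym (R-j b a c)))
                                        (λ r r≢i r≢j c → trans (B≈ r r≢i r≢j c) (sym (R-other b a r r≢i r≢j c)))) ⟩
    D b a    ≈⟨ +-inverseˡ-unique (D b a) (D a b) D-antisym ⟩
    - D a b  ≈⟨ -‿cong (det-cong n (rows-agree (R-i a b) (R-j a b) (R-other a b))) ⟩
    - det n A ∎
    where
    a b s : Fin n → Carrier
    a = A i
    b = A j
    s = λ c → a c + b c
    R : (Fin n → Carrier) → (Fin n → Carrier) → Matrix n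
    R u v = (A [ j ]≔ v) [ i ]≔ u
    D : (Fin n → Carrier) → (Fin n → Carrier) → Carrier
    D u v = det n (R u v)
    R-i : ∀ u v → R u v i ≈ᵛ u
    R-i u v = []≔-at (A [ j ]≔ v) i u
    R-j : ∀ u v → R u v j ≈ᵛ v
    R-j u v c = trans ([]≔-off (A [ j ]≔ v) i u j (i≢j ∘ ≡.sym) c) ([]≔-at A j v c)
    R-other : ∀ u v r → r ≢ i → r ≢ j → R u v r ≈ᵛ A r
    R-other u v r r≢i r≢j c = trans ([]≔-off (A [ j ]≔ v) i u r r≢i c) ([]≔-off A j v r r≢j c)
    R-off-i : ∀ u u′ v r → r ≢ i → R u v r ≈ᵛ R u′ v r
    R-off-i u u′ v r r≢i c = trans ([]≔-off (A [ j ]≔ v) i u r r≢i c) (sym ([]≔-off (A [ j ]≔ v) i u′ r r≢i c))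
    R-off-j : ∀ u v v′ r → r ≢ j → R u v r ≈ᵛ R u v′ r
    R-off-j u v v′ r r≢j with r ≟ i
    ... | yes ≡.refl = λ c → trans (R-i u v c) (sym (R-i u v′ c))
    ... | no r≢i     = λ c → trans (R-other u v r r≢i r≢j c) (sym (R-other u v′ r r≢i r≢j c))
    D-diag : ∀ u → D u u ≈ 0#
    D-diag u = alt (R u u) i≢j (λ c → trans (R-i u u c) (sym (R-j u u c)))
    D-addˡ : ∀ u u′ v → D (λ c → u c + u′ c) v ≈ D u v + D u′ v
    D-addˡ u u′ v = det-additive n _ _ _ i
      (λ c → trans (R-i _ v c) (sym (+-cong (R-i u v c) (R-i u′ v c))))
      (λ r r≢i → R-off-i _ u v r r≢i) (λ r r≢i → R-off-i _ u′ v r r≢i)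
    D-addʳ : ∀ u v v′ → D u (λ c → v c + v′ c) ≈ D u v + D u v′
    D-addʳ u v v′ = det-additive n _ _ _ j
      (λ c → trans (R-j u _ c) (sym (+-cong (R-j u v c) (R-j u v′ c))))
      (λ r r≢j → R-off-j u _ v r r≢j) (λ r r≢j → R-off-j u _ v′ r r≢j)
    D-antisym : D b a + D a b ≈ 0#
    D-antisym = begin
      D b a + D a b                        ≈⟨ +-comm _ _ ⟩
      D a b + D b a                        ≈⟨ +-cong (+-identityˡ _) (+-identityʳ _) ⟨
      (0# + D a b) + (D b a + 0#)          ≈⟨ +-cong (+-congʳ (D-diag a)) (+-congˡ (D-diag b)) ⟨
      (D a a + D a b) + (D b a + D b b)    ≈⟨ +-cong (D-addʳ a a b) (D-addʳ b a b) ⟨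
      D a s + D b s                        ≈⟨ D-addˡ a b s ⟨
      D s s                                ≈⟨ D-diag s ⟩
      0#                                   ∎

  det-swapBelowFirst : ∀ n → Antisymmetric n → ∀ (A B : Matrix (suc n)) {i j} → i ≢ j →
    B fzero ≈ᵛ A fzero → B (fsuc i) ≈ᵛ A (fsuc j) → B (fsuc j) ≈ᵛ A (fsuc i) →
    (∀ r → r ≢ i → r ≢ j → B (fsuc r) ≈ᵛ A (fsuc r)) → det (suc n) B ≈ - det (suc n) A
  det-swapBelowFirst n antisym A B i≢j B₀≈ Bᵢ≈ Bⱼ≈ B≈ =
    trans (altSum-cong (suc n) {g = λ k → - (A fzero k * det n (minor A k))} (λ k →
            trans (*-cong (B₀≈ k) (antisym (minor A k) (minor B k) i≢j (Bᵢ≈ ∘ punchIn k) (Bⱼ≈ ∘ punchIn k)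
                                    (λ r r≢i r≢j → B≈ r r≢i r≢j ∘ punchIn k)))
                  (sym (-‿distribʳ-* _ _))))
          (altSum-neg (suc n) (λ k → A fzero k * det n (minor A k)))

  swapRows : ∀ {n} → Matrix n → Fin n → Fin n → Matrix n
  swapRows A i j = (A [ i ]≔ A j) [ j ]≔ A i

  -- Swapping row 1 with row j puts two equal rows on top.
  det-firstRow≈⇒det≈0 : ∀ n → Antisymmetric n → ∀ (A : Matrix (suc n)) j → A fzero ≈ᵛ A (fsuc j) →
                         det (suc n) A ≈ 0#
  det-firstRow≈⇒det≈0 (suc m) antisym A fzero    A₀≈A₁ = det-rows₀₁≈⇒det≈0 m A (sym ∘ A₀≈A₁)
  det-firstRow≈⇒det≈0 (suc m) antisym A (fsuc j) A₀≈Aⱼ = begin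
    det (suc (suc m)) A       ≈⟨ -‿involutive _ ⟨
    - - det (suc (suc m)) A   ≈⟨ -‿cong detB≈-detA ⟨
    - det (suc (suc m)) B     ≈⟨ -‿cong (det-rows₀₁≈⇒det≈0 m B (λ c → trans (B₁≈ c) (sym (trans (B≈ fzero (λ ()) (λ ()) c) (A₀≈Aⱼ c))))) ⟩
    - 0#                      ≈⟨ -0#≈0# ⟩
    0#                        ∎
    where
    one j′ : Fin (suc (suc m))
    one = fsuc fzero
    j′  = fsuc (fsuc j)
    B : Matrix (suc (suc m))
    B = swapRows A one j′
    B₁≈ : B one ≈ᵛ A j′
    B₁≈ c = trans ([]≔-off (A [ one ]≔ A j′) j′ (A one) one (λ ()) c) ([]≔-at A one (A j′) c)
    B₂≈ : B j′ ≈ᵛ A one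
    B₂≈ = []≔-at (A [ one ]≔ A j′) j′ (A one)
    B≈ : ∀ r → r ≢ one → r ≢ j′ → B r ≈ᵛ A r
    B≈ r r≢1 r≢j′ c = trans ([]≔-off (A [ one ]≔ A j′) j′ (A one) r r≢j′ c) ([]≔-off A one (A j′) r r≢1 c)
    detB≈-detA : det (suc (suc m)) B ≈ - det (suc (suc m)) A
    detB≈-detA = det-swapBelowFirst (suc m) antisym A B {fzero} {fsuc j} (λ ())
      (B≈ fzero (λ ()) (λ ())) B₁≈ B₂≈
      (λ r r≢0 r≢j → B≈ (fsuc r) (r≢0 ∘ suc-injective) (r≢j ∘ suc-injective))

  det-alternating : ∀ n → Alternating n
  det-alternating zero    A {()}
  det-alternating (suc n) A {fzero}  {fzero}  i≢j = ⊥-elim (i≢j ≡.refl)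
  det-alternating (suc n) A {fzero}  {fsuc j} _   A₀≈Aⱼ =
    det-firstRow≈⇒det≈0 n (alternating⇒antisymmetric n (det-alternating n)) A j A₀≈Aⱼ
  det-alternating (suc n) A {fsuc i} {fzero}  _   Aᵢ≈A₀ =
    det-firstRow≈⇒det≈0 n (alternating⇒antisymmetric n (det-alternating n)) A i (sym ∘ Aᵢ≈A₀)
  det-alternating (suc n) A {fsuc i} {fsuc j} i≢j Aᵢ≈Aⱼ =
    altSum-zero (suc n) (λ k → trans (*-congˡ (det-alternating n (minor A k) (i≢j ∘ ≡.cong fsuc) (Aᵢ≈Aⱼ ∘ punchIn k)))
                                     (zeroʳ (A fzero k)))

  det-expandRow : ∀ n Q (A : Matrix n) i (w : Fin Q → Carrier) (V : Fin Q → Fin n → Carrier) →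
    A i ≈ᵛ (λ c → sumF Q (λ q → w q * V q c)) → det n A ≈ sumF Q (λ q → w q * det n (A [ i ]≔ V q))
  det-expandRow n zero    A i w V Aᵢ≈0 = det-zeroRow n A i Aᵢ≈0
  det-expandRow n (suc Q) A i w V Aᵢ≈ = begin
    det n A
      ≈⟨ det-linear n A (A [ i ]≔ V fzero) (A [ i ]≔ rest) i (w fzero)
           (λ c → trans (Aᵢ≈ c) (+-cong (*-congˡ (sym ([]≔-at A i (V fzero) c))) (sym ([]≔-at A i rest c))))
           (λ r r≢i c → sym ([]≔-off A i (V fzero) r r≢i c))
           (λ r r≢i c → sym ([]≔-off A i rest r r≢i c)) ⟩
    w fzero * det n (A [ i ]≔ V fzero) + det n (A [ i ]≔ rest)
      ≈⟨ +-congˡ (det-expandRow n Q (A [ i ]≔ rest) i (w ∘ fsuc) (V ∘ fsuc) ([]≔-at A i rest)) ⟩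
    w fzero * det n (A [ i ]≔ V fzero) + sumF Q (λ q → w (fsuc q) * det n ((A [ i ]≔ rest) [ i ]≔ V (fsuc q)))
      ≈⟨ +-congˡ (sumF-cong Q (λ q → *-congˡ (det-cong-≗ n ([]≔-[]≔ A i rest (V (fsuc q)))))) ⟩
    sumF (suc Q) (λ q → w q * det n (A [ i ]≔ V q)) ∎
    where
    rest : Fin n → Carrier
    rest c = sumF Q (λ q → w (fsuc q) * V (fsuc q) c)

  det-δ : ∀ n → det n δ ≈ 1#
  det-δ zero    = refl
  det-δ (suc n) = begin
    1# * det n δ - altSum n (λ j → 0# * det n (minor δ (fsuc j)))
      ≈⟨ +-cong (trans (*-identityˡ _) (det-δ n)) (trans (-‿cong (altSum-zero n (λ j → zeroˡ _))) -0#≈0#) ⟩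
    1# + 0#  ≈⟨ +-identityʳ 1# ⟩
    1#       ∎

  collision-or-surjective : ∀ N (τ : Fin N → Fin N) →
    (Σ (Fin N) λ i → Σ (Fin N) λ j → i ≢ j × τ i ≡ τ j) ⊎ (∀ r → Σ (Fin N) λ l → τ l ≡ r)
  collision-or-surjective N τ with all? (λ r → any? (λ l → τ l ≟ r))
  ... | yes surjective = inj₂ surjective
  ... | no ¬surjective with ¬∀⟶∃¬ N _ (λ r → any? (λ l → τ l ≟ r)) ¬surjective
  collision-or-surjective (suc N) τ | no _ | r , r∉im
    with i , j , i<j , eq ← pigeonhole (ℕ.n<1+n N) (λ l → punchOut (r∉im ∘ (l ,_) ∘ ≡.sym))
    = inj₁ (i , j , <⇒≢ i<j , punchOut-injective (r∉im ∘ (i ,_) ∘ ≡.sym) (r∉im ∘ (j ,_) ∘ ≡.sym) eq)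

  module _ {N} (Y : Matrix N) (ν : Fin N → Carrier)
           (νY≈0 : ∀ q → sumF N (λ r → ν r * Y r q) ≈ 0#) (k : Fin N) where

    -- A collision repeats a row; otherwise τ hits k, and replacing that row by Σ_r ν_r Y_r = 0
    -- only adds terms with a repeated row.
    ν·det-rowsOfY : ∀ (τ : Fin N → Fin N) → ν k * det N (Y ∘ τ) ≈ 0#
    ν·det-rowsOfY τ with collision-or-surjective N τ
    ... | inj₁ (i , j , i≢j , τi≡τj) =
      trans (*-congˡ (det-alternating N (Y ∘ τ) i≢j (≡⇒≈ᵛ (≡.cong Y τi≡τj)))) (zeroʳ _)
    ... | inj₂ surjective = begin
      ν k * det N (Y ∘ τ)
        ≈⟨ *-congˡ (det-cong N (λ r → Yτ≈ r (r ≟ l₀))) ⟨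
      ν k * det N ((Y ∘ τ) [ l₀ ]≔ Y k)
        ≈⟨ sumF-single N (λ r → ν r * det N ((Y ∘ τ) [ l₀ ]≔ Y r)) k repeated ⟨
      sumF N (λ r → ν r * det N ((Y ∘ τ) [ l₀ ]≔ Y r))
        ≈⟨ sumF-cong N (λ r → *-congˡ (det-cong-≗ N ([]≔-[]≔ (Y ∘ τ) l₀ νY (Y r)))) ⟨
      sumF N (λ r → ν r * det N (((Y ∘ τ) [ l₀ ]≔ νY) [ l₀ ]≔ Y r))
        ≈⟨ det-expandRow N N ((Y ∘ τ) [ l₀ ]≔ νY) l₀ ν Y ([]≔-at (Y ∘ τ) l₀ νY) ⟨
      det N ((Y ∘ τ) [ l₀ ]≔ νY)
        ≈⟨ det-zeroRow N _ l₀ (λ c → trans ([]≔-at (Y ∘ τ) l₀ νY c) (νY≈0 c)) ⟩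
      0# ∎
      where
      νY : Fin N → Carrier
      νY c = sumF N (λ r → ν r * Y r c)
      l₀ : Fin N
      l₀ = proj₁ (surjective k)
      Yτ≈ : ∀ r → Dec (r ≡ l₀) → ((Y ∘ τ) [ l₀ ]≔ Y k) r ≈ᵛ Y (τ r)
      Yτ≈ r (yes ≡.refl) c = trans ([]≔-at (Y ∘ τ) r (Y k) c) (reflexive (≡.cong (λ t → Y t c) (≡.sym (proj₂ (surjective k)))))
      Yτ≈ r (no r≢l₀)    = []≔-off (Y ∘ τ) l₀ (Y k) r r≢l₀
      repeated : ∀ r → r ≢ k → ν r * det N ((Y ∘ τ) [ l₀ ]≔ Y r) ≈ 0#
      repeated r r≢k = trans (*-congˡ (det-alternating N _ l≢l₀ (λ c →
          trans ([]≔-off (Y ∘ τ) l₀ (Y r) l l≢l₀ c)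
            (trans (reflexive (≡.cong (λ t → Y t c) (proj₂ (surjective r)))) (sym ([]≔-at (Y ∘ τ) l₀ (Y r) c))))))
        (zeroʳ _)
        where
        l : Fin N
        l = proj₁ (surjective r)
        l≢l₀ : l ≢ l₀
        l≢l₀ l≡l₀ = r≢k (≡.trans (≡.sym (proj₂ (surjective r))) (≡.trans (≡.cong τ l≡l₀) (proj₂ (surjective k))))

    RowsOfYFrom : ℕ → Matrix N → Set ℓ
    RowsOfYFrom d Z = ∀ i → d ≤ toℕ i → Σ (Fin N) λ r → Z i ≈ᵛ Y r

    RowsInSpanOfY : Matrix N → Set (c ⊔ ℓ)
    RowsInSpanOfY Z = ∀ i → Σ (Fin N → Carrier) λ w → Z i ≈ᵛ (λ c → sumF N (λ r → w r * Y r c))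

    -- Expand rows d-1, …, 0 of Z multilinearly into rows of Y.
    ν·det-rowsInSpanOfY : ∀ d Z → RowsOfYFrom d Z → RowsInSpanOfY Z → ν k * det N Z ≈ 0#
    ν·det-rowsInSpanOfY zero Z fromY _ =
      trans (*-congˡ (det-cong N (λ i → proj₂ (fromY i z≤n)))) (ν·det-rowsOfY (λ i → proj₁ (fromY i z≤n)))
    ν·det-rowsInSpanOfY (suc d) Z fromY inSpan with d ℕ.<? N
    ... | no d≮N = ν·det-rowsInSpanOfY d Z (λ i d≤i → ⊥-elim (d≮N (ℕ.≤-<-trans d≤i (toℕ<n i)))) inSpan
    ... | yes d<N = begin
      ν k * det N Z
        ≈⟨ *-congˡ (det-expandRow N N Z i₀ w Y Zᵢ₀≈) ⟩
      ν k * sumF N (λ r → w r * det N (Z [ i₀ ]≔ Y r))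
        ≈⟨ *-distribˡ-sumF N (ν k) _ ⟩
      sumF N (λ r → ν k * (w r * det N (Z [ i₀ ]≔ Y r)))
        ≈⟨ sumF-zero N (λ r → trans (x∙yz≈y∙xz (ν k) (w r) _)
             (trans (*-congˡ (ν·det-rowsInSpanOfY d (Z [ i₀ ]≔ Y r) (fromY′ r) (inSpan′ r))) (zeroʳ _))) ⟩
      0# ∎
      where
      i₀ : Fin N
      i₀ = fromℕ< d<N
      w : Fin N → Carrier
      w = proj₁ (inSpan i₀)
      Zᵢ₀≈ : Z i₀ ≈ᵛ (λ c → sumF N (λ r → w r * Y r c))
      Zᵢ₀≈ = proj₂ (inSpan i₀)
      fromY′ : ∀ r → RowsOfYFrom d (Z [ i₀ ]≔ Y r)
      fromY′ r i d≤i with i ≟ i₀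
      ... | yes ≡.refl = r , []≔-at Z i₀ (Y r)
      ... | no i≢i₀    = proj₁ (fromY i 1+d≤i) , λ c → trans ([]≔-off Z i₀ (Y r) i i≢i₀ c) (proj₂ (fromY i 1+d≤i) c)
        where
        1+d≤i : suc d ≤ toℕ i
        1+d≤i = ℕ.≤∧≢⇒< d≤i (λ d≡i → i≢i₀ (toℕ-injective (≡.trans (≡.sym d≡i) (≡.sym (toℕ-fromℕ< d<N)))))
      inSpan′ : ∀ r → RowsInSpanOfY (Z [ i₀ ]≔ Y r)
      inSpan′ r i with i ≟ i₀
      ... | yes ≡.refl = δ r , λ c → trans ([]≔-at Z i₀ (Y r) c)
                                       (sym (trans (sumF-single N _ r (λ r′ r′≢r → trans (*-congʳ (δ-off r r′ (r′≢r ∘ ≡.sym))) (zeroˡ _)))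
                                                   (trans (*-congʳ (δ-diag r)) (*-identityˡ _))))
      ... | no i≢i₀    = proj₁ (inSpan i) , λ c → trans ([]≔-off Z i₀ (Y r) i i≢i₀ c) (proj₂ (inSpan i) c)

  -- ν_k = ν_k det I, and the rows of I = X Y lie in the span of the rows of Y.
  left-invertible⇒rows-independent : ∀ N (X Y : Matrix N) →
    (∀ q q′ → sumF N (λ r → X q r * Y r q′) ≈ δ q q′) →
    ∀ ν → (∀ q → sumF N (λ r → ν r * Y r q) ≈ 0#) → ∀ k → ν k ≈ 0#
  left-invertible⇒rows-independent N X Y XY≈I ν νY≈0 k = begin
    ν k             ≈⟨ *-identityʳ _ ⟨
    ν k * 1#        ≈⟨ *-congˡ (det-δ N) ⟨
    ν k * det N δ   ≈⟨ ν·det-rowsInSpanOfY Y ν νY≈0 k N δ (λ i N≤i → ⊥-elim (ℕ.<⇒≱ (toℕ<n i) N≤i))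
                         (λ q → X q , λ c → sym (XY≈I q c)) ⟩
    0#              ∎

  -- F^p-linear combinations and norm fields

  module Frobenius (p : ℕ) (char : HasChar p) where

    frob : Carrier → Carrier
    frob x = pow x p

    frob-cong : ∀ {x y} → x ≈ y → frob x ≈ frob y
    frob-cong = pow-cong p

    frob-* : ∀ x y → frob (x * y) ≈ frob x * frob y
    frob-* = pow-distrib-* p

    frob-+ : ∀ x y → frob (x + y) ≈ frob x + frob y
    frob-+ = pow-+-char char

    p≡1+pred : p ≡ suc (pred p)
    p≡1+pred = ≡.sym (ℕ.suc-pred p {{prime⇒nonZero (proj₁ char)}})

    frob-0 : frob 0# ≈ 0#
    frob-0 = trans (reflexive (≡.cong (pow 0#) p≡1+pred)) (zeroˡ _)

    frob-1 : frob 1# ≈ 1#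
    frob-1 = pow-1 p

    frob-neg : ∀ x → frob (- x) ≈ - frob x
    frob-neg x = +-inverseʳ-unique (frob x) (frob (- x))
      (trans (sym (frob-+ x (- x))) (trans (frob-cong (-‿inverseʳ x)) frob-0))

    frob-sumF : ∀ n (f : Fin n → Carrier) → frob (sumF n f) ≈ sumF n (λ i → frob (f i))
    frob-sumF zero    f = frob-0
    frob-sumF (suc n) f = trans (frob-+ _ _) (+-congˡ (frob-sumF n (λ i → f (fsuc i))))

    inv≈frob[inv]*pow : ∀ y (y≉0 : ¬ (y ≈ 0#)) → inv y y≉0 ≈ frob (inv y y≉0) * pow y (pred p)
    inv≈frob[inv]*pow y y≉0 = sym (begin
      pow y⁻¹ p * pow y (pred p)                ≡⟨ ≡.cong (λ k → pow y⁻¹ k * pow y (pred p)) p≡1+pred ⟩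
      (y⁻¹ * pow y⁻¹ (pred p)) * pow y (pred p) ≈⟨ *-assoc _ _ _ ⟩
      y⁻¹ * (pow y⁻¹ (pred p) * pow y (pred p)) ≈⟨ *-congˡ (sym (pow-distrib-* (pred p) y⁻¹ y)) ⟩
      y⁻¹ * pow (y⁻¹ * y) (pred p)              ≈⟨ *-congˡ (pow-cong (pred p) (trans (*-comm y⁻¹ y) (inv-law y y≉0))) ⟩
      y⁻¹ * pow 1# (pred p)                     ≈⟨ *-congˡ (pow-1 (pred p)) ⟩
      y⁻¹ * 1#                                  ≈⟨ *-identityʳ y⁻¹ ⟩
      y⁻¹                                       ∎)
      where
      y⁻¹ : Carrier
      y⁻¹ = inv y y≉0

    -- F^p-linear combinations; as in HasNDeg, an element of F^p is written as a p-th power λᵢᵖ.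
    combᵖ : ∀ {k} → (Fin k → Carrier) → (Fin k → Carrier) → Carrier
    combᵖ {k} λ′ e = sumF k (λ i → frob (λ′ i) * e i)

    Independentᵖ : ∀ {k} → (Fin k → Carrier) → Set (c ⊔ ℓ)
    Independentᵖ {k} e = ∀ λ′ → combᵖ λ′ e ≈ 0# → ∀ i → λ′ i ≈ 0#

    _∈Spanᵖ_ : ∀ {k} → Carrier → (Fin k → Carrier) → Set (c ⊔ ℓ)
    _∈Spanᵖ_ {k} x e = Σ (Fin k → Carrier) λ λ′ → x ≈ combᵖ λ′ e

    combᵖ-congʳ : ∀ {k} λ′ {e e′ : Fin k → Carrier} → (∀ i → e i ≈ e′ i) → combᵖ λ′ e ≈ combᵖ λ′ e′
    combᵖ-congʳ {k} λ′ e≈e′ = sumF-cong k (λ i → *-congˡ (e≈e′ i))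

    combᵖ-zero : ∀ {k} {λ′ : Fin k → Carrier} e → (∀ i → λ′ i ≈ 0#) → combᵖ λ′ e ≈ 0#
    combᵖ-zero {k} e λ′≈0 = sumF-zero k (λ i → trans (*-congʳ (trans (frob-cong (λ′≈0 i)) frob-0)) (zeroˡ _))

    combᵖ-+ : ∀ {k} (λ′ μ e : Fin k → Carrier) → combᵖ (λ i → λ′ i + μ i) e ≈ combᵖ λ′ e + combᵖ μ e
    combᵖ-+ {k} λ′ μ e = trans (sumF-cong k (λ i → trans (*-congʳ (frob-+ _ _)) (distribʳ _ _ _)))
                                (sumF-distrib-+ k _ _)

    combᵖ-neg : ∀ {k} (λ′ e : Fin k → Carrier) → combᵖ (λ i → - λ′ i) e ≈ - combᵖ λ′ e
    combᵖ-neg {k} λ′ e = trans (sumF-cong k (λ i → trans (*-congʳ (frob-neg _)) (sym (-‿distribˡ-* _ _))))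
                                (sym (-‿distrib-sumF k _))

    combᵖ-scale : ∀ {k} t (λ′ e : Fin k → Carrier) → frob t * combᵖ λ′ e ≈ combᵖ (λ i → t * λ′ i) e
    combᵖ-scale {k} t λ′ e = trans (*-distribˡ-sumF k _ _)
      (sumF-cong k (λ i → trans (sym (*-assoc _ _ _)) (*-congʳ (sym (frob-* t (λ′ i))))))

    combᵖ-single : ∀ {k} (e : Fin k → Carrier) q → combᵖ (δ q) e ≈ e q
    combᵖ-single {k} e q = trans
      (sumF-single k _ q (λ i i≢q → trans (*-congʳ (trans (frob-cong (δ-off q i (i≢q ∘ ≡.sym))) frob-0)) (zeroˡ _)))
      (trans (*-congʳ (trans (frob-cong (δ-diag q)) frob-1)) (*-identityˡ _))

    combᵖ-scaleʳ : ∀ {k} (λ′ : Fin k → Carrier) w u → combᵖ λ′ (λ i → w * u i) ≈ w * combᵖ λ′ u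
    combᵖ-scaleʳ {k} λ′ w u = trans (sumF-cong k (λ i → x∙yz≈y∙xz _ w _)) (sym (*-distribˡ-sumF k w _))

    -- frob is a ring homomorphism, so p-linear combinations compose like linear ones.
    combᵖ-combᵖ : ∀ {R Q} (ν : Fin R → Carrier) (Y : Fin R → Fin Q → Carrier) v →
      combᵖ ν (λ r → combᵖ (Y r) v) ≈ combᵖ (λ q → sumF R (λ r → ν r * Y r q)) v
    combᵖ-combᵖ {R} {Q} ν Y v = begin
      sumF R (λ r → frob (ν r) * sumF Q (λ q → frob (Y r q) * v q))
        ≈⟨ sumF-cong R (λ r → *-distribˡ-sumF Q (frob (ν r)) _) ⟩
      sumF R (λ r → sumF Q (λ q → frob (ν r) * (frob (Y r q) * v q)))
        ≈⟨ sumF-comm R Q _ ⟩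
      sumF Q (λ q → sumF R (λ r → frob (ν r) * (frob (Y r q) * v q)))
        ≈⟨ sumF-cong Q (λ q → sumF-cong R (λ r → trans (sym (*-assoc _ _ _)) (*-congʳ (sym (frob-* (ν r) (Y r q)))))) ⟩
      sumF Q (λ q → sumF R (λ r → frob (ν r * Y r q) * v q))
        ≈⟨ sumF-cong Q (λ q → trans (sym (*-distribʳ-sumF R (v q) _)) (*-congʳ (sym (frob-sumF R _)))) ⟩
      sumF Q (λ q → frob (sumF R (λ r → ν r * Y r q)) * v q) ∎

    combᵖ-⊗ : ∀ {n m} (α e : Fin n → Carrier) (β f : Fin m → Carrier) →
              combᵖ α e * combᵖ β f ≈ combᵖ (α ⊗ β) (e ⊗ f)
    combᵖ-⊗ {n} {m} α e β f = begin
      combᵖ α e * combᵖ β f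
        ≈⟨ *-distribʳ-sumF n _ _ ⟩
      sumF n (λ i → (frob (α i) * e i) * combᵖ β f)
        ≈⟨ sumF-cong n (λ i → *-distribˡ-sumF m _ _) ⟩
      sumF n (λ i → sumF m (λ j → (frob (α i) * e i) * (frob (β j) * f j)))
        ≈⟨ sumF-cong n (λ i → sumF-cong m (λ j → trans (interchange _ _ _ _) (*-congʳ (sym (frob-* (α i) (β j)))))) ⟩
      sumF n (λ i → sumF m (λ j → frob (α i * β j) * (e i * f j)))
        ≈⟨ sumF-remQuot n m (λ i j → frob (α i * β j) * (e i * f j)) ⟨
      combᵖ (α ⊗ β) (e ⊗ f) ∎

    combᵖ-vanishes : ∀ {n k} (ν u : Fin n → Carrier) (α : Fin n → Fin k → Carrier) e →
      (∀ i → u i ≈ combᵖ (α i) e) → (∀ s → sumF n (λ i → ν i * α i s) ≈ 0#) → combᵖ ν u ≈ 0#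
    combᵖ-vanishes ν u α e u≈ να≈0 = trans (combᵖ-congʳ ν u≈) (trans (combᵖ-combᵖ ν α e) (combᵖ-zero e να≈0))

    independentᵖ⇒coords-unique : ∀ {k} {e : Fin k → Carrier} → Independentᵖ e →
      ∀ λ′ μ → combᵖ λ′ e ≈ combᵖ μ e → ∀ i → λ′ i ≈ μ i
    independentᵖ⇒coords-unique {e = e} indep λ′ μ same i =
      x∙y⁻¹≈ε⇒x≈y _ _ (indep (λ i → λ′ i - μ i) (begin
        combᵖ (λ i → λ′ i + - μ i) e     ≈⟨ combᵖ-+ λ′ _ e ⟩
        combᵖ λ′ e + combᵖ (λ i → - μ i) e ≈⟨ +-congˡ (combᵖ-neg μ e) ⟩
        combᵖ λ′ e - combᵖ μ e            ≈⟨ +-congʳ same ⟩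
        combᵖ μ e - combᵖ μ e             ≈⟨ -‿inverseʳ _ ⟩
        0#                                ∎) i)

    record IsSubfieldᵖ (S : Carrier → Set (c ⊔ ℓ)) : Set (c ⊔ ℓ) where
      field
        ≈-resp     : ∀ {x y} → x ≈ y → S x → S y
        frob∈      : ∀ y → S (frob y)
        +-closed   : ∀ {x y} → S x → S y → S (x + y)
        *-closed   : ∀ {x y} → S x → S y → S (x * y)
        neg-closed : ∀ {x} → S x → S (- x)
        inv-closed : ∀ {x} → S x → (x≉0 : ¬ (x ≈ 0#)) → S (inv x x≉0)

    InN-isSubfieldᵖ : ∀ {n} (χ : QForm n) → IsSubfieldᵖ (InN p χ)
    InN-isSubfieldᵖ χ = record
      { ≈-resp = resp ; frob∈ = pth ; +-closed = add ; *-closed = mul ; neg-closed = neg ; inv-closed = inve }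

    -- Every quotient a / b of values equals (a w) / (b w).
    InN-⊆ : ∀ {n} {χ : QForm n} {S} → IsSubfieldᵖ S → ∀ w → ¬ (w ≈ 0#) →
            (∀ a → InD* p χ a → S (a * w)) → ∀ {x} → InN p χ x → S x
    InN-⊆ {χ = χ} {S} S-subfield w w≉0 scaled∈S = go
      where
      open IsSubfieldᵖ S-subfield
      go : ∀ {x} → InN p χ x → S x
      go (pth y)                  = frob∈ y
      go (quot a b a∈D* b∈D*)     = ≈-resp (xd/yd≈x/y a b w (proj₁ b∈D*) bw≉0)
        (*-closed (scaled∈S a a∈D*) (inv-closed (scaled∈S b b∈D*) bw≉0))
        where
        bw≉0 : ¬ (b * w ≈ 0#)
        bw≉0 = x≉0∧y≉0⇒xy≉0 (proj₁ b∈D*) w≉0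
      go (add x∈N y∈N)            = +-closed (go x∈N) (go y∈N)
      go (mul x∈N y∈N)            = *-closed (go x∈N) (go y∈N)
      go (neg x∈N)                = neg-closed (go x∈N)
      go (inve x∈N x≉0)           = inv-closed (go x∈N) x≉0
      go (resp x≈y x∈N)           = ≈-resp x≈y (go x∈N)

    module _ {k} (h : Fin k → Carrier) where

      ∈Spanᵖ-resp : ∀ {x y} → x ≈ y → x ∈Spanᵖ h → y ∈Spanᵖ h
      ∈Spanᵖ-resp x≈y (λ′ , x≈) = λ′ , trans (sym x≈y) x≈

      ∈Spanᵖ-+ : ∀ {x y} → x ∈Spanᵖ h → y ∈Spanᵖ h → (x + y) ∈Spanᵖ h
      ∈Spanᵖ-+ (λ′ , x≈) (μ , y≈) = (λ r → λ′ r + μ r) , trans (+-cong x≈ y≈) (sym (combᵖ-+ λ′ μ h))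

      ∈Spanᵖ-neg : ∀ {x} → x ∈Spanᵖ h → (- x) ∈Spanᵖ h
      ∈Spanᵖ-neg (λ′ , x≈) = (λ r → - λ′ r) , trans (-‿cong x≈) (sym (combᵖ-neg λ′ h))

      ∈Spanᵖ-scale : ∀ t {x} → x ∈Spanᵖ h → (frob t * x) ∈Spanᵖ h
      ∈Spanᵖ-scale t (λ′ , x≈) = (λ r → t * λ′ r) , trans (*-congˡ x≈) (combᵖ-scale t λ′ h)

      ∈Spanᵖ-combᵖ : ∀ {n} (λ′ u : Fin n → Carrier) → (∀ i → u i ∈Spanᵖ h) → combᵖ λ′ u ∈Spanᵖ h
      ∈Spanᵖ-combᵖ {n} λ′ u u∈ =
        (λ r → sumF n (λ i → λ′ i * proj₁ (u∈ i) r)) ,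
        trans (sumF-cong n (λ i → *-congˡ (proj₂ (u∈ i)))) (combᵖ-combᵖ λ′ (λ i → proj₁ (u∈ i)) h)

      module _ (1∈ : 1# ∈Spanᵖ h) (hh∈ : ∀ r r′ → (h r * h r′) ∈Spanᵖ h) where

        ∈Spanᵖ-* : ∀ {x y} → x ∈Spanᵖ h → y ∈Spanᵖ h → (x * y) ∈Spanᵖ h
        ∈Spanᵖ-* {x} {y} (λ′ , x≈) (μ , y≈) =
          ∈Spanᵖ-resp (sym xy≈) (∈Spanᵖ-combᵖ λ′ _ (λ r →
            ∈Spanᵖ-resp (sym (hy≈ r)) (∈Spanᵖ-combᵖ μ _ (λ r′ → hh∈ r r′))))
          where
          xy≈ : x * y ≈ combᵖ λ′ (λ r → h r * y)
          xy≈ = trans (*-congʳ x≈) (trans (*-distribʳ-sumF k y _) (sumF-cong k (λ r → *-assoc _ _ _)))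
          hy≈ : ∀ r → h r * y ≈ combᵖ μ (λ r′ → h r * h r′)
          hy≈ r = trans (*-congˡ y≈) (trans (*-distribˡ-sumF k (h r) _)
                    (sumF-cong k (λ r′ → x∙yz≈y∙xz (h r) _ _)))

        ∈Spanᵖ-pow : ∀ n {x} → x ∈Spanᵖ h → pow x n ∈Spanᵖ h
        ∈Spanᵖ-pow zero    x∈ = 1∈
        ∈Spanᵖ-pow (suc n) x∈ = ∈Spanᵖ-* x∈ (∈Spanᵖ-pow n x∈)

        spanᵖ-isSubfieldᵖ : IsSubfieldᵖ (_∈Spanᵖ h)
        spanᵖ-isSubfieldᵖ = record
          { ≈-resp     = ∈Spanᵖ-resp
          ; frob∈      = λ y → ∈Spanᵖ-resp (*-identityʳ (frob y)) (∈Spanᵖ-scale y 1∈)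
          ; +-closed   = ∈Spanᵖ-+
          ; *-closed   = ∈Spanᵖ-*
          ; neg-closed = ∈Spanᵖ-neg
          ; inv-closed = λ {x} x∈ x≉0 → ∈Spanᵖ-resp (sym (inv≈frob[inv]*pow x x≉0))
                                          (∈Spanᵖ-scale (inv x x≉0) (∈Spanᵖ-pow (pred p) x∈))
          }

    independentᵖ-transfer : ∀ {N} {g h : Fin N → Carrier} → Independentᵖ g →
      (∀ q → g q ∈Spanᵖ h) → (∀ r → h r ∈Spanᵖ g) → Independentᵖ h
    independentᵖ-transfer {N} {g} {h} g-indep g∈ h∈ ν νh≈0 =
      left-invertible⇒rows-independent N X Y XY≈I ν νY≈0
      where
      X Y : Matrix N
      X q = proj₁ (g∈ q)
      Y r = proj₁ (h∈ r)
      through-h : ∀ λ′ → combᵖ (λ q → sumF N (λ r → λ′ r * Y r q)) g ≈ combᵖ λ′ h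
      through-h λ′ = trans (sym (combᵖ-combᵖ λ′ Y g)) (combᵖ-congʳ λ′ (λ r → sym (proj₂ (h∈ r))))
      XY≈I : ∀ q q′ → sumF N (λ r → X q r * Y r q′) ≈ δ q q′
      XY≈I q = independentᵖ⇒coords-unique g-indep _ (δ q)
        (trans (through-h (X q)) (trans (sym (proj₂ (g∈ q))) (sym (combᵖ-single g q))))
      νY≈0 : ∀ q → sumF N (λ r → ν r * Y r q) ≈ 0#
      νY≈0 = g-indep _ (trans (through-h ν) νh≈0)

    eval≈combᵖ : ∀ {n} (χ : QForm n) x → eval p χ x ≈ combᵖ x χ
    eval≈combᵖ {n} χ x = sumF-cong n (λ i → *-comm (χ i) _)

    eval-⊗ : ∀ {n m} (φ : QForm n) (ψ : QForm m) x y → eval p (φ ⊗ ψ) (x ⊗ y) ≈ eval p φ x * eval p ψ y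
    eval-⊗ φ ψ x y = trans (eval≈combᵖ (φ ⊗ ψ) (x ⊗ y))
      (sym (trans (*-cong (eval≈combᵖ φ x) (eval≈combᵖ ψ y)) (combᵖ-⊗ x φ y ψ)))

    eval-δ : ∀ {n} (χ : QForm n) i → eval p χ (δ i) ≈ χ i
    eval-δ χ i = trans (eval≈combᵖ χ (δ i)) (combᵖ-single χ i)

    anisotropic⇒coeff≉0 : ∀ {n} {χ : QForm n} → Anisotropic p χ → ∀ i → ¬ (χ i ≈ 0#)
    anisotropic⇒coeff≉0 {χ = χ} aniso i χᵢ≈0 =
      1≉0 (trans (sym (δ-diag i)) (aniso (δ i) (trans (eval-δ χ i) χᵢ≈0) i))

    coeff∈D* : ∀ {n} {χ : QForm n} → Anisotropic p χ → ∀ i → InD* p χ (χ i)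
    coeff∈D* {χ = χ} aniso i = anisotropic⇒coeff≉0 aniso i , δ i , eval-δ χ i

    D*-⊗ : ∀ {n m} {φ : QForm n} {ψ : QForm m} {a b} → InD* p φ a → InD* p ψ b → InD* p (φ ⊗ ψ) (a * b)
    D*-⊗ {φ = φ} {ψ} (a≉0 , x , φx≈a) (b≉0 , y , ψy≈b) =
      x≉0∧y≉0⇒xy≉0 a≉0 b≉0 , x ⊗ y , trans (eval-⊗ φ ψ x y) (*-cong φx≈a ψy≈b)

    InN-⊗ˡ : ∀ {n m} {φ : QForm n} {ψ : QForm m} {a₀ b} → InD* p φ a₀ → InD* p ψ b →
             ∀ {x} → InN p φ x → InN p (φ ⊗ ψ) x
    InN-⊗ˡ {a₀ = a₀} {b} a₀∈D* b∈D* = InN-⊆ (InN-isSubfieldᵖ _) (inv a₀ (proj₁ a₀∈D*)) (inv-nonzero a₀ _)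
      (λ a a∈D* → resp (xd/yd≈x/y a a₀ b (proj₁ a₀∈D*) _) (quot _ _ (D*-⊗ a∈D* b∈D*) (D*-⊗ a₀∈D* b∈D*)))

    InN-⊗ʳ : ∀ {n m} {φ : QForm n} {ψ : QForm m} {a b₀} → InD* p φ a → InD* p ψ b₀ →
             ∀ {y} → InN p ψ y → InN p (φ ⊗ ψ) y
    InN-⊗ʳ {a = a} {b₀} a∈D* b₀∈D* = InN-⊆ (InN-isSubfieldᵖ _) (inv b₀ (proj₁ b₀∈D*)) (inv-nonzero b₀ _)
      (λ b b∈D* → resp (dx/dy≈x/y b b₀ a (proj₁ b₀∈D*) _) (quot _ _ (D*-⊗ a∈D* b∈D*) (D*-⊗ a∈D* b₀∈D*)))

    module _ {n} (χ : QForm n) (i₀ : Fin n) (χ₀≉0 : ¬ (χ i₀ ≈ 0#)) where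

      normalise : QForm n
      normalise i = χ i * inv (χ i₀) χ₀≉0

      eval≈coeff*normalise : ∀ x → eval p χ x ≈ χ i₀ * combᵖ x normalise
      eval≈coeff*normalise x = trans (eval≈combᵖ χ x)
        (trans (combᵖ-congʳ x (λ i → sym (y*[x/y]≈x (χ i) (χ i₀) χ₀≉0))) (combᵖ-scaleʳ x (χ i₀) normalise))

    -- χ(ν) = χ i₀ · Σₛ (Σᵢ νᵢ αᵢₛ)ᵖ eₛ.
    anisotropic-coords : ∀ {n k} {χ : QForm n} (aniso : Anisotropic p χ) i₀ (α : Fin n → Fin k → Carrier) e →
      (∀ i → normalise χ i₀ (anisotropic⇒coeff≉0 aniso i₀) i ≈ combᵖ (α i) e) →
      ∀ ν → (∀ s → sumF n (λ i → ν i * α i s) ≈ 0#) → ∀ i → ν i ≈ 0#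
    anisotropic-coords {χ = χ} aniso i₀ α e c≈ ν να≈0 = aniso ν (begin
      eval p χ ν                                 ≈⟨ eval≈coeff*normalise χ i₀ _ ν ⟩
      χ i₀ * combᵖ ν (normalise χ i₀ _)          ≈⟨ *-congˡ (combᵖ-vanishes ν _ α e c≈ να≈0) ⟩
      χ i₀ * 0#                                  ≈⟨ zeroʳ _ ⟩
      0#                                         ∎)

    -- Anisotropy of φ ⊗ ψ

    module NDeg {n} {χ : QForm n} {k} (ndeg : HasNDeg p χ k) where

      basis : Fin k → Carrier
      basis = proj₁ ndeg

      basis∈N : ∀ i → InN p χ (basis i)
      basis∈N = proj₁ (proj₂ ndeg)

      basis-independent : Independentᵖ basis
      basis-independent = proj₁ (proj₂ (proj₂ ndeg))

      N⊆span : ∀ {x} → InN p χ x → x ∈Spanᵖ basis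
      N⊆span = proj₂ (proj₂ (proj₂ ndeg)) _

    module ⊗-Anisotropic {n m} {φ : QForm n} {ψ : QForm m}
      (φ-aniso : Anisotropic p φ) (ψ-aniso : Anisotropic p ψ) {a b}
      (φ-ndeg : HasNDeg p φ a) (ψ-ndeg : HasNDeg p ψ b) (φψ-ndeg : HasNDeg p (φ ⊗ ψ) (a *ℕ b))
      (i₀ : Fin n) (j₀ : Fin m) where

      open NDeg φ-ndeg using () renaming (basis to e; basis∈N to e∈N; N⊆span to span-e)
      open NDeg ψ-ndeg using () renaming (basis to f; basis∈N to f∈N; N⊆span to span-f)
      open NDeg φψ-ndeg using () renaming (basis-independent to g-independent; basis∈N to g∈N; N⊆span to span-g)

      φ₀∈D* : InD* p φ (φ i₀)
      φ₀∈D* = coeff∈D* φ-aniso i₀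
      ψ₀∈D* : InD* p ψ (ψ j₀)
      ψ₀∈D* = coeff∈D* ψ-aniso j₀

      φ̂ : QForm n
      φ̂ = normalise φ i₀ (proj₁ φ₀∈D*)
      ψ̂ : QForm m
      ψ̂ = normalise ψ j₀ (proj₁ ψ₀∈D*)

      φ̂∈N : ∀ i → InN p φ (φ̂ i)
      φ̂∈N i = quot _ _ (coeff∈D* φ-aniso i) φ₀∈D*
      ψ̂∈N : ∀ j → InN p ψ (ψ̂ j)
      ψ̂∈N j = quot _ _ (coeff∈D* ψ-aniso j) ψ₀∈D*

      w : Carrier
      w = φ i₀ * ψ j₀
      w≉0 : ¬ (w ≈ 0#)
      w≉0 = proj₁ (D*-⊗ φ₀∈D* ψ₀∈D*)

      eval-⊗≈w*combᵖ : ∀ x → eval p (φ ⊗ ψ) x ≈ w * combᵖ x (φ̂ ⊗ ψ̂)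
      eval-⊗≈w*combᵖ x = trans (eval≈combᵖ (φ ⊗ ψ) x)
        (trans (combᵖ-congʳ x (λ k → trans (sym (*-cong (y*[x/y]≈x _ (φ i₀) _) (y*[x/y]≈x _ (ψ j₀) _)))
                                            (interchange _ _ _ _)))
               (combᵖ-scaleʳ x w (φ̂ ⊗ ψ̂)))

      products∈span : ∀ {u v} → InN p φ u → InN p ψ v → (u * v) ∈Spanᵖ (e ⊗ f)
      products∈span u∈N v∈N with span-e u∈N | span-f v∈N
      ... | α , u≈ | β , v≈ = α ⊗ β , trans (*-cong u≈ v≈) (combᵖ-⊗ α e β f)

      span[e⊗f]-isSubfieldᵖ : IsSubfieldᵖ (_∈Spanᵖ (e ⊗ f))
      span[e⊗f]-isSubfieldᵖ = spanᵖ-isSubfieldᵖ (e ⊗ f)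
        (∈Spanᵖ-resp (e ⊗ f) (*-identityˡ 1#) (products∈span 1∈N 1∈N))
        (λ r r′ → ∈Spanᵖ-resp (e ⊗ f) (interchange _ _ _ _)
          (products∈span (mul (e∈N _) (e∈N _)) (mul (f∈N _) (f∈N _))))
        where
        1∈N : ∀ {k} {χ : QForm k} → InN p χ 1#
        1∈N = resp frob-1 (pth 1#)

      N[φ⊗ψ]⊆span[e⊗f] : ∀ {x} → InN p (φ ⊗ ψ) x → x ∈Spanᵖ (e ⊗ f)
      N[φ⊗ψ]⊆span[e⊗f] = InN-⊆ span[e⊗f]-isSubfieldᵖ (inv w w≉0) (inv-nonzero w w≉0) λ where
        a (_ , v , φψv≈a) → ∈Spanᵖ-resp (e ⊗ f)
          (trans (sym (yx/y≈x _ w w≉0)) (*-congʳ (trans (sym (eval-⊗≈w*combᵖ v)) φψv≈a)))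
          (∈Spanᵖ-combᵖ (e ⊗ f) v (φ̂ ⊗ ψ̂) (λ k → products∈span (φ̂∈N _) (ψ̂∈N _)))

      e⊗f-independent : Independentᵖ (e ⊗ f)
      e⊗f-independent = independentᵖ-transfer g-independent (λ q → N[φ⊗ψ]⊆span[e⊗f] (g∈N q))
        (λ r → span-g (mul (InN-⊗ˡ φ₀∈D* ψ₀∈D* (e∈N _)) (InN-⊗ʳ φ₀∈D* ψ₀∈D* (f∈N _))))

      α : Fin n → Fin a → Carrier
      α i = proj₁ (span-e (φ̂∈N i))
      β : Fin m → Fin b → Carrier
      β j = proj₁ (span-f (ψ̂∈N j))

      anisotropic : ∀ x → eval p (φ ⊗ ψ) x ≈ 0# → ∀ k → x k ≈ 0#
      anisotropic x φψx≈0 k = begin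
        x k                                                     ≡⟨ ≡.cong x (combine-remQuot {n} m k) ⟨
        x (combine (proj₁ (remQuot {n} m k)) (proj₂ (remQuot {n} m k))) ≈⟨ xᵢⱼ≈0 _ _ ⟩
        0#                                                      ∎
        where
        Γ : Fin (n *ℕ m) → Fin (a *ℕ b) → Carrier
        Γ k = α (proj₁ (remQuot {n} m k)) ⊗ β (proj₂ (remQuot {n} m k))
        Γ-combine : ∀ k s t → Γ k (combine s t) ≡ ((λ i → α i s) ⊗ (λ j → β j t)) k
        Γ-combine k s t = ≡.cong (λ st → α (proj₁ (remQuot {n} m k)) (proj₁ st) * β (proj₂ (remQuot {n} m k)) (proj₂ st))
                                 (remQuot-combine s t)
        xΓ≈0 : ∀ r → sumF (n *ℕ m) (λ k → x k * Γ k r) ≈ 0#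
        xΓ≈0 = e⊗f-independent _ (begin
          combᵖ (λ r → sumF (n *ℕ m) (λ k → x k * Γ k r)) (e ⊗ f)
            ≈⟨ combᵖ-combᵖ x Γ (e ⊗ f) ⟨
          combᵖ x (λ k → combᵖ (Γ k) (e ⊗ f))
            ≈⟨ combᵖ-congʳ x (λ k → sym (trans (*-cong (proj₂ (span-e (φ̂∈N _))) (proj₂ (span-f (ψ̂∈N _))))
                                               (combᵖ-⊗ _ e _ f))) ⟩
          combᵖ x (φ̂ ⊗ ψ̂)
            ≈⟨ x≉0∧xy≈0⇒y≈0 w≉0 (trans (sym (eval-⊗≈w*combᵖ x)) φψx≈0) ⟩
          0# ∎)
        μ : Fin b → Fin n → Carrier
        μ t i = sumF m (λ j → x (combine i j) * β j t)
        μα≈0 : ∀ t s → sumF n (λ i → μ t i * α i s) ≈ 0#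
        μα≈0 t s = begin
          sumF n (λ i → μ t i * α i s)                                    ≈⟨ sumF-*-⊗ n m x _ _ ⟨
          sumF (n *ℕ m) (λ k → x k * ((λ i → α i s) ⊗ (λ j → β j t)) k)   ≈⟨ sumF-cong (n *ℕ m) (λ k → *-congˡ (reflexive (Γ-combine k s t))) ⟨
          sumF (n *ℕ m) (λ k → x k * Γ k (combine s t))                   ≈⟨ xΓ≈0 (combine s t) ⟩
          0#                                                              ∎
        μ≈0 : ∀ t i → μ t i ≈ 0#
        μ≈0 t = anisotropic-coords φ-aniso i₀ α e (λ i → proj₂ (span-e (φ̂∈N i))) (μ t) (μα≈0 t)
        xᵢⱼ≈0 : ∀ i j → x (combine i j) ≈ 0#
        xᵢⱼ≈0 i = anisotropic-coords ψ-aniso j₀ β f (λ j → proj₂ (span-f (ψ̂∈N j))) (λ j → x (combine i j)) (λ t → μ≈0 t i)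

open import Data.Nat using (_*_)

lemma2p12 : {c ℓ : Level} (F : Field c ℓ) (p : ℕ) → FieldTheory.HasChar F p →
  {n m : ℕ} (φ : FieldTheory.QForm F n) (ψ : FieldTheory.QForm F m) →
  FieldTheory.Anisotropic F p φ → FieldTheory.Anisotropic F p ψ →
  Σ ℕ (λ a → Σ ℕ (λ b →
    FieldTheory.HasNDeg F p φ a × FieldTheory.HasNDeg F p ψ b ×
    FieldTheory.HasNDeg F p (FieldTheory._⊗_ F φ ψ) (a * b))) →
  FieldTheory.Anisotropic F p (FieldTheory._⊗_ F φ ψ)
lemma2p12 F p char {n} {m} φ ψ φ-aniso ψ-aniso (a , b , φ-ndeg , ψ-ndeg , φψ-ndeg) x φψx≈0 k =
  ⊗-Anisotropic.anisotropic {φ = φ} {ψ = ψ} φ-aniso ψ-aniso φ-ndeg ψ-ndeg φψ-ndeg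
    (proj₁ (remQuot {n} m k)) (proj₂ (remQuot {n} m k)) x φψx≈0 k
  where open Frobenius F p char
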